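{- Let $K_{n,n}$ have parts $\{u_0,\ldots,u_{n-1}\}$ and $\{v_0,\ldots,v_{n-1}\}$ and consider the vertex order $u_0 \prec \cdots \prec u_{n-1} \prec v_0 \prec \cdots \prec v_{n-1}$. Map each edge $(u_i,v_j)$ to the grid point $(i,j)$ of $H=\{0,\ldots,n-1\}\times\{0,\ldots,n-1\}$. Let $\mathcal{L}$ be an $s$-stack $q$-queue layout of $K_{n,n}$ with this vertex order. Then the set of grid points corresponding to the edges of any single queue of $\mathcal{L}$ forms a (not necessarily strictly) monotonically increasing path on $H$, i.e., its points can be listed as $p_1,\ldots,p_m$ so that each $p_{t+1}$ is coordinatewise greater than or equal to $p_t$; and the set of grid points corresponding to the edges of any single stack of $\mathcal{L}$ forms a (not necessarily strictly) monotonically decreasing path on $H$, i.e., its points can be listed as $p_1,\ldots,p_m$ so that each $p_{t+1}$ has $x$-coordinate at least and $y$-coordinate at most that of $p_t$.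
   Context: Given a total vertex order $\prec$, two edges $(a_1,b_1)$, $(a_2,b_2)$ with four distinct endpoints and $a_1\prec b_1$, $a_2 \prec b_2$, $a_1 \prec a_2$ are said to cross if $a_1 \prec a_2 \prec b_1 \prec b_2$, and to nest if $a_1 \prec a_2 \prec b_2 \prec b_1$. A stack is a set of edges no two of which cross; a queue is a set of edges no two of which nest. An $s$-stack $q$-queue layout is a vertex order together with a partition of the edges into $s$ stacks and $q$ queues with respect to it. -}

module Defs where

open import Data.Nat using (ℕ; _+_; _<_; _≤_)
open import Data.Fin using (Fin; toℕ)
open import Data.Product using (_×_; _,_)
open import Data.Sum using (_⊎_; inj₁; inj₂)
open import Data.List using (List)
open import Data.List.Membership.Propositional using (_∈_)
open import Data.List.Relation.Unary.Unique.Propositional using (Unique)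
open import Data.List.Relation.Unary.Linked using (Linked)
open import Relation.Binary.PropositionalEquality using (_≡_)
open import Relation.Nullary using (¬_)

-- An edge given by the positions (in the vertex order) of its two endpoints,
-- left endpoint first.
PosEdge : Set
PosEdge = ℕ × ℕ

CrossOrd : PosEdge → PosEdge → Set
CrossOrd (a₁ , b₁) (a₂ , b₂) = a₁ < a₂ × a₂ < b₁ × b₁ < b₂

NestOrd : PosEdge → PosEdge → Set
NestOrd (a₁ , b₁) (a₂ , b₂) = a₁ < a₂ × a₂ < b₂ × b₂ < b₁

Cross : PosEdge → PosEdge → Set
Cross e f = CrossOrd e f ⊎ CrossOrd f e

Nest : PosEdge → PosEdge → Set
Nest e f = NestOrd e f ⊎ NestOrd f e

-- K_{n,n}: vertices u_i at position i, v_j at position n + j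
-- (order u_0 ≺ … ≺ u_{n-1} ≺ v_0 ≺ … ≺ v_{n-1}); the edge u_i v_j is
-- identified with the grid point (i , j).
GridPt : ℕ → Set
GridPt n = Fin n × Fin n

edgePos : (n : ℕ) → GridPt n → PosEdge
edgePos n (i , j) = toℕ i , n + toℕ j

record Layout (n s q : ℕ) : Set where
  field
    page      : GridPt n → Fin s ⊎ Fin q
    stackOK   : ∀ k e f → page e ≡ inj₁ k → page f ≡ inj₁ k →
                ¬ Cross (edgePos n e) (edgePos n f)
    queueOK   : ∀ k e f → page e ≡ inj₂ k → page f ≡ inj₂ k →
                ¬ Nest (edgePos n e) (edgePos n f)

IncStep : ∀ {n} → GridPt n → GridPt n → Set
IncStep (x₁ , y₁) (x₂ , y₂) = toℕ x₁ ≤ toℕ x₂ × toℕ y₁ ≤ toℕ y₂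

DecStep : ∀ {n} → GridPt n → GridPt n → Set
DecStep (x₁ , y₁) (x₂ , y₂) = toℕ x₁ ≤ toℕ x₂ × toℕ y₂ ≤ toℕ y₁

ListedAsPath : ∀ {n} → (GridPt n → GridPt n → Set) → (GridPt n → Set) → Set
ListedAsPath {n} R P =
  Data.Product.Σ (List (GridPt n)) λ ps →
    (∀ p → (p ∈ ps → P p) × (P p → p ∈ ps)) × Unique ps × Linked R ps

-- List the edges of K_{n,n} lexicographically: by the left endpoint u_i and
-- then by the right endpoint v_j, ascending for a queue and descending for a
-- stack. Two edges u_i v_j, u_i' v_j' with i < i' and j' < j nest, and with
-- i < i' and j < j' they cross; so inside one queue (stack) every later edge
-- has a larger (smaller) j, unless it shares the left endpoint, where the
-- tie-breaking order already gives this. The edges of the page, in this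
-- order, are therefore the required path.
module Submission where

open import Defs
open import Level using (Level)
open import Data.Nat using (ℕ; _+_; s≤s)
import Data.Nat as ℕ
open import Data.Nat.Properties using (<⇒≤; ≤-refl; ≤-trans; m≤m+n; +-monoʳ-<; ∸-monoʳ-<; ≰⇒>; _≤?_)
open import Data.Fin using (Fin; toℕ; opposite; _<_)
open import Data.Fin.Properties using (toℕ<n; <-irrefl; _≟_; opposite-prop; opposite-involutive)
open import Data.Product using (_×_; _,_; proj₁; proj₂)
open import Data.Product.Relation.Binary.Lex.Strict using (×-Lex; ×-irreflexive)
open import Data.Product.Relation.Binary.Pointwise.NonDependent using (≡⇒≡×≡)
open import Data.Sum using (inj₁; inj₂)
open import Data.Sum.Properties using (≡-dec)
open import Data.List using (List; []; _∷_; tabulate; filter; cartesianProduct; allFin)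
open import Data.List.Membership.Propositional using (_∈_)
open import Data.List.Membership.Propositional.Properties
  using (∈-tabulate⁺; ∈-allFin; ∈-cartesianProduct⁺; ∈-cartesianProduct⁻; ∈-filter⁺; ∈-filter⁻)
open import Data.List.Relation.Unary.All as All using (All; []; _∷_)
open import Data.List.Relation.Unary.All.Properties using (all-filter) renaming (map⁺ to All-map⁺)
open import Data.List.Relation.Unary.AllPairs as AllPairs using (AllPairs; []; _∷_)
import Data.List.Relation.Unary.AllPairs.Properties as AllPairs
open import Data.List.Relation.Unary.Linked.Properties using (AllPairs⇒Linked)
open import Function using (flip)
open import Relation.Binary using (Rel; Irreflexive)
open import Relation.Binary.PropositionalEquality using (_≡_; refl; sym; subst)
open import Relation.Nullary using (yes; no; contradiction)
open import Relation.Unary using (Pred; Decidable)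

private variable
  a b : Level
  A B : Set a

AllPairs-restrict : ∀ {P : Pred A b} {R S : Rel A b} {xs} → All P xs →
  (∀ {x y} → P x → P y → R x y → S x y) → AllPairs R xs → AllPairs S xs
AllPairs-restrict [] f [] = []
AllPairs-restrict (px ∷ pxs) f (rx ∷ rxs) =
  All.zipWith (λ (py , r) → f px py r) (pxs , rx) ∷ AllPairs-restrict pxs f rxs

All-cartesianProduct-proj₁ : ∀ {P : Pred A a} {xs} (ys : List B) →
  All P xs → All (λ p → P (proj₁ p)) (cartesianProduct xs ys)
All-cartesianProduct-proj₁ {xs = xs} ys pxs =
  All.tabulate (λ p∈ → All.lookup pxs (proj₁ (∈-cartesianProduct⁻ xs ys p∈)))

cartesianProduct-sorted : ∀ {_<₁_ : Rel A a} {_<₂_ : Rel B a} {xs ys} →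
  AllPairs _<₁_ xs → AllPairs _<₂_ ys →
  AllPairs (×-Lex _≡_ _<₁_ _<₂_) (cartesianProduct xs ys)
cartesianProduct-sorted [] ys-sorted = []
cartesianProduct-sorted {ys = ys} (x<xs ∷ xs-sorted) ys-sorted =
  AllPairs.++⁺
    (AllPairs.map⁺ (AllPairs.map (λ y<y′ → inj₂ (refl , y<y′)) ys-sorted))
    (cartesianProduct-sorted xs-sorted ys-sorted)
    (All-map⁺ (All.universal (λ _ → All.map inj₁ (All-cartesianProduct-proj₁ ys x<xs)) ys))

filter-listedAsPath : ∀ {n} {_≺_ R : Rel (GridPt n) _} {P : Pred (GridPt n) _} →
  Irreflexive _≡_ _≺_ → (P? : Decidable P) (xs : List (GridPt n)) →
  (∀ p → p ∈ xs) → AllPairs _≺_ xs →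
  (∀ {x y} → P x → P y → x ≺ y → R x y) → ListedAsPath R P
filter-listedAsPath irrefl P? xs complete sorted step =
    filter P? xs
  , (λ p → (λ p∈ → proj₂ (∈-filter⁻ P? {xs = xs} p∈)) , ∈-filter⁺ P? (complete p))
  , AllPairs.map (λ x≺y x≡y → irrefl x≡y x≺y) sorted′
  , AllPairs⇒Linked (AllPairs-restrict (all-filter P? xs) step sorted′)
  where
  sorted′ = AllPairs.filter⁺ P? sorted

allFin-increasing : ∀ n → AllPairs _<_ (allFin n)
allFin-increasing n = AllPairs.tabulate⁺-< (λ i<j → i<j)

allFinDescending : ∀ n → List (Fin n)
allFinDescending n = tabulate opposite

∈-allFinDescending : ∀ {n} (j : Fin n) → j ∈ allFinDescending n
∈-allFinDescending j =
  subst (_∈ tabulate opposite) (opposite-involutive j) (∈-tabulate⁺ (opposite j))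

allFinDescending-decreasing : ∀ n → AllPairs (flip _<_) (allFinDescending n)
allFinDescending-decreasing n = AllPairs.tabulate⁺-< opposite-<
  where
  opposite-< : ∀ {i j : Fin n} → i < j → opposite j < opposite i
  opposite-< {i} {j} i<j rewrite opposite-prop i | opposite-prop j =
    ∸-monoʳ-< (s≤s i<j) (toℕ<n j)

×-Lex-irreflexive : ∀ {_<₁_ : Rel A a} {_<₂_ : Rel B a} →
  Irreflexive _≡_ _<₁_ → Irreflexive _≡_ _<₂_ →
  Irreflexive _≡_ (×-Lex _≡_ _<₁_ _<₂_)
×-Lex-irreflexive {_<₁_ = _<₁_} {_<₂_} irrefl₁ irrefl₂ x≡y =
  ×-irreflexive {_<₁_ = _<₁_} {_<₂_ = _<₂_} irrefl₁ irrefl₂ (≡⇒≡×≡ x≡y)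

leftEnd<rightEnd : ∀ n (i j : Fin n) → toℕ i ℕ.< n + toℕ j
leftEnd<rightEnd n i j = ≤-trans (toℕ<n i) (m≤m+n n (toℕ j))

nest-of-descent : ∀ {n} {i i′ j j′ : Fin n} → i < i′ → j′ < j →
  NestOrd (edgePos n (i , j)) (edgePos n (i′ , j′))
nest-of-descent {n} {i′ = i′} {j′ = j′} i<i′ j′<j =
  i<i′ , leftEnd<rightEnd n i′ j′ , +-monoʳ-< n j′<j

cross-of-ascent : ∀ {n} {i i′ j j′ : Fin n} → i < i′ → j < j′ →
  CrossOrd (edgePos n (i , j)) (edgePos n (i′ , j′))
cross-of-ascent {n} {i′ = i′} {j = j} i<i′ j<j′ =
  i<i′ , leftEnd<rightEnd n i′ j , +-monoʳ-< n j<j′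

module _ {n s q} (L : Layout n s q) where
  open Layout L

  queue-increasing : ∀ {k x y} → page x ≡ inj₂ k → page y ≡ inj₂ k →
    ×-Lex _≡_ _<_ _<_ x y → IncStep x y
  queue-increasing {x = _ , j} {_ , j′} px py (inj₁ i<i′) with toℕ j ≤? toℕ j′
  ... | yes j≤j′ = <⇒≤ i<i′ , j≤j′
  ... | no  j≰j′ =
    contradiction (inj₁ (nest-of-descent i<i′ (≰⇒> j≰j′))) (queueOK _ _ _ px py)
  queue-increasing px py (inj₂ (refl , j<j′)) = ≤-refl , <⇒≤ j<j′

  stack-decreasing : ∀ {k x y} → page x ≡ inj₁ k → page y ≡ inj₁ k →
    ×-Lex _≡_ _<_ (flip _<_) x y → DecStep x y
  stack-decreasing {x = _ , j} {_ , j′} px py (inj₁ i<i′) with toℕ j′ ≤? toℕ j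
  ... | yes j′≤j = <⇒≤ i<i′ , j′≤j
  ... | no  j′≰j =
    contradiction (inj₁ (cross-of-ascent i<i′ (≰⇒> j′≰j))) (stackOK _ _ _ px py)
  stack-decreasing px py (inj₂ (refl , j′<j)) = ≤-refl , <⇒≤ j′<j

proposition1 : (n s q : ℕ) (L : Layout n s q) →
    (∀ (k : Fin q) → ListedAsPath IncStep (λ p → Layout.page L p ≡ inj₂ k))
    × (∀ (k : Fin s) → ListedAsPath DecStep (λ p → Layout.page L p ≡ inj₁ k))
proposition1 n s q L = queues , stacks
  where
  open Layout L

  onPage? : ∀ c → Decidable (λ p → page p ≡ c)
  onPage? c p = ≡-dec _≟_ _≟_ (page p) c

  queues : ∀ k → ListedAsPath IncStep (λ p → page p ≡ inj₂ k)
  queues k = filter-listedAsPath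
    (×-Lex-irreflexive <-irrefl <-irrefl) (onPage? (inj₂ k))
    (cartesianProduct (allFin n) (allFin n))
    (λ (i , j) → ∈-cartesianProduct⁺ (∈-allFin i) (∈-allFin j))
    (cartesianProduct-sorted (allFin-increasing n) (allFin-increasing n))
    (queue-increasing L)

  stacks : ∀ k → ListedAsPath DecStep (λ p → page p ≡ inj₁ k)
  stacks k = filter-listedAsPath
    (×-Lex-irreflexive <-irrefl (λ i≡j → <-irrefl (sym i≡j))) (onPage? (inj₁ k))
    (cartesianProduct (allFin n) (allFinDescending n))
    (λ (i , j) → ∈-cartesianProduct⁺ (∈-allFin i) (∈-allFinDescending j))
    (cartesianProduct-sorted (allFin-increasing n) (allFinDescending-decreasing n))
    (stack-decreasing L)
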